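{- Let $m\ge 3$ and $n\ge 2$. For every positive integer $k$, $$\chi^b_{B_m^n}(2k)=\Big[\sum_{i=0}^{m-2}(-1)^i(2k-1)^{(m-2)-i}\Big]\,\chi^b_{B_m^{n-1}}(2k).$$
   Context: A signed graph $(G,\sigma)$ is a finite graph $G$ (parallel edges allowed) with a sign function $\sigma:E(G)\to\{+1,-1\}$. A zero-free signed coloring in $2k$ colors is a map $c:V(G)\to\{ -k,\dots,-1,1,\dots,k\}$; it is proper if $c(y)\neq\sigma(e)c(x)$ for every edge $e=xy$. The balanced chromatic polynomial $\chi^b_{(G,\sigma)}(2k)$ is the number of proper zero-free signed colorings in $2k$ colors. For integers $m\ge 3$, $n\ge 1$, the Book graph $B(m,n)$ has vertex set $\{u,v\}\cup\{u_j^l:1\le l\le n,\,1\le j\le m-2\}$ and consists of the $n$ cycles $u\,u_1^l\cdots u_{m-2}^l\,v\,u$ sharing the edge $uv$. The signed graph $B_m^n$ is obtained from $B(m,n)$ with all edges positive by replacing the edge $uv$ with two parallel edges between $u$ and $v$, one positive and one negative. -}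

module Defs where

open import Data.Nat as ℕ using (ℕ; zero; suc; _∸_)
open import Data.Integer as ℤ using (ℤ; +_; -_)
open import Data.Fin using (Fin; zero; suc; _↑ʳ_; combine)
open import Data.List using (List; []; _∷_; _++_; map; concatMap; allFin; upTo; foldr; filter; length)
open import Data.List.Relation.Unary.All using (All; all?)
open import Data.Vec using (Vec; []; _∷_; lookup)
open import Data.Product using (_×_; _,_)
open import Relation.Binary.PropositionalEquality using (_≡_)
open import Relation.Nullary using (¬_; Dec; ¬?)

data Sign : Set where
  pos neg : Sign

⟦_⟧ : Sign → ℤ
⟦ pos ⟧ = + 1
⟦ neg ⟧ = - (+ 1)

record SignedGraph : Set where
  field
    N     : ℕ
    edges : List (Fin N × Fin N × Sign)  -- edge multiset x y σ(e)
open SignedGraph public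

-- Zero-free signed colours in 2k colours: {-k..-1,1..k}

colours : ℕ → List ℤ
colours k = concatMap (λ i → + suc i ∷ - (+ suc i) ∷ []) (upTo k)

allVecs : {A : Set} (n : ℕ) → List A → List (Vec A n)
allVecs zero    xs = [] ∷ []
allVecs (suc n) xs = concatMap (λ x → map (x ∷_) (allVecs n xs)) xs

ProperEdge : {N : ℕ} → Vec ℤ N → Fin N × Fin N × Sign → Set
ProperEdge c (x , y , s) = ¬ (lookup c y ≡ ⟦ s ⟧ ℤ.* lookup c x)

properEdge? : {N : ℕ} (c : Vec ℤ N) (e : Fin N × Fin N × Sign) → Dec (ProperEdge c e)
properEdge? c (x , y , s) = ¬? (lookup c y ℤ.≟ ⟦ s ⟧ ℤ.* lookup c x)

Proper : (G : SignedGraph) → Vec ℤ (N G) → Set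
Proper G c = All (ProperEdge c) (edges G)

proper? : (G : SignedGraph) (c : Vec ℤ (N G)) → Dec (Proper G c)
proper? G c = all? (properEdge? c) (edges G)

-- balanced chromatic polynomial evaluated at 2k
χb : SignedGraph → ℕ → ℕ
χb G k = length (filter (proper? G) (allVecs (N G) (colours k)))

-- The signed Book graph B_m^n.
-- Vertices: u = 0, v = 1, u_j^l = 2 + (l·(m-2) + j)  (0-indexed l, j).

pathEdges : {N : ℕ} → List (Fin N) → List (Fin N × Fin N × Sign)
pathEdges []              = []
pathEdges (x ∷ [])        = []
pathEdges (x ∷ y ∷ xs)    = (x , y , pos) ∷ pathEdges (y ∷ xs)

BookSigned : (m n : ℕ) → SignedGraph
BookSigned m n = record
  { N     = 2 ℕ.+ n ℕ.* (m ∸ 2)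
  ; edges = (u , v , pos) ∷ (u , v , neg) ∷ concatMap page (allFin n)
  }
  where
    u v : Fin (2 ℕ.+ n ℕ.* (m ∸ 2))
    u = zero
    v = suc zero
    w : Fin n → Fin (m ∸ 2) → Fin (2 ℕ.+ n ℕ.* (m ∸ 2))
    w l j = 2 ↑ʳ combine l j
    page : Fin n → List (Fin (2 ℕ.+ n ℕ.* (m ∸ 2)) × Fin (2 ℕ.+ n ℕ.* (m ∸ 2)) × Sign)
    page l = pathEdges (u ∷ (map (w l) (allFin (m ∸ 2)) ++ (v ∷ [])))

bookFactor : ℕ → ℕ → ℤ
bookFactor m k =
  foldr (λ i acc → ((- (+ 1)) ℤ.^ i) ℤ.* ((+ (2 ℕ.* k ∸ 1)) ℤ.^ ((m ∸ 2) ∸ i)) ℤ.+ acc)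
        (+ 0) (upTo (suc (m ∸ 2)))

-- Write p = m - 2 and q = 2k = r + 2.  A zero-free colouring c of B_m^n is proper iff
-- c(v) ≠ ±c(u) (the two parallel edges uv) and, on every page, consecutive vertices of the
-- positive path u, u_1^l, …, u_p^l, v get distinct colours.  The pages only share u and v, so
--   χᵇ(B_m^n) = Σ_a Σ_b [b ≠ a][b ≠ -a] · walks(p, a, b)^n,
-- where walks(p, a, b) counts the colourings of the p inner vertices of such a path with end
-- colours a, b.  In a palette of r + 2 colours, walks(p, a, b) depends only on whether a = b:
-- it is equalEnds r p or distinctEnds r p, given by a two-term recursion on p (choose the
-- colour of the first inner vertex).  Whenever the uv factor is nonzero we have a ≠ b, so each
-- summand for n equals distinctEnds r p times the summand for n - 1.  Finally distinctEnds r p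
-- satisfies S(p+1) + S(p) = (r+1)^(p+1), which is also the recursion of the alternating sum.

module Submission where

open import Defs
open import Data.Bool using (Bool; true; false; _∧_)
open import Data.Empty using (⊥-elim)
open import Data.Fin using (Fin; zero; suc; _↑ʳ_; combine)
open import Data.Integer as ℤ using (ℤ; +_; -_; ∣_∣; _≟_)
import Data.Integer.Properties as ℤP
import Data.Integer.Tactic.RingSolver as ℤSolver
open import Data.List using (List; []; _∷_; _++_; map; concatMap; allFin; upTo; applyUpTo; foldr; filter; length; tabulate)
open import Data.List.Membership.Propositional using (_∈_)
open import Data.List.Membership.Propositional.Properties using (∈-++⁻)
open import Data.List.Properties using (map-++; map-tabulate; tabulate-cong; concatMap-++; ++-identityʳ; length-++; upTo-∷ʳ)
open import Data.List.Relation.Unary.All using (all?)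
open import Data.List.Relation.Unary.Any using (here; there)
open import Data.Nat using (ℕ; zero; suc; _+_; _*_; _^_; _∸_; _≤_; s≤s)
import Data.Nat.Properties as ℕP
open import Data.Nat.Tactic.RingSolver using (solve-∀)
open import Data.Product using (_×_; _,_)
open import Data.Sum using (_⊎_; inj₁; inj₂)
open import Data.Vec as Vec using (Vec; []; _∷_; lookup)
open import Data.Vec.Properties using (lookup-++ˡ; lookup-++ʳ)
open import Function using (_∘_; id)
open import Level using (0ℓ)
open import Relation.Binary.PropositionalEquality using (_≡_; _≢_; refl; sym; trans; cong; cong₂; subst; module ≡-Reasoning)
open import Relation.Nullary using (¬_; Dec; yes; no; does; ¬?)
open import Relation.Unary using (Pred; Decidable)

open ≡-Reasoning

private
  variable
    A B : Set

𝟙ᵇ : Bool → ℕ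
𝟙ᵇ true  = 1
𝟙ᵇ false = 0

𝟙 : Dec A → ℕ
𝟙 d = 𝟙ᵇ (does d)

𝟙ᵇ-∧ : ∀ b c → 𝟙ᵇ (b ∧ c) ≡ 𝟙ᵇ b * 𝟙ᵇ c
𝟙ᵇ-∧ true  c = sym (ℕP.+-identityʳ (𝟙ᵇ c))
𝟙ᵇ-∧ false c = refl

𝟙-yes : A → (d : Dec A) → 𝟙 d ≡ 1
𝟙-yes a (yes _) = refl
𝟙-yes a (no ¬a) = ⊥-elim (¬a a)

𝟙-no : ¬ A → (d : Dec A) → 𝟙 d ≡ 0
𝟙-no ¬a (yes a) = ⊥-elim (¬a a)
𝟙-no ¬a (no _)  = refl

𝟙-⇔ : (A → B) → (B → A) → (d : Dec A) (e : Dec B) → 𝟙 d ≡ 𝟙 e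
𝟙-⇔ f g (yes a) e = sym (𝟙-yes (f a) e)
𝟙-⇔ f g (no ¬a) e = sym (𝟙-no (¬a ∘ g) e)

∑ : List A → (A → ℕ) → ℕ
∑ []       f = 0
∑ (x ∷ xs) f = f x + ∑ xs f

∏ : List A → (A → ℕ) → ℕ
∏ []       f = 1
∏ (x ∷ xs) f = f x * ∏ xs f

∑-++ : (xs ys : List A) (f : A → ℕ) → ∑ (xs ++ ys) f ≡ ∑ xs f + ∑ ys f
∑-++ []       ys f = refl
∑-++ (x ∷ xs) ys f = trans (cong (_+_ (f x)) (∑-++ xs ys f)) (sym (ℕP.+-assoc (f x) _ _))

∏-++ : (xs ys : List A) (f : A → ℕ) → ∏ (xs ++ ys) f ≡ ∏ xs f * ∏ ys f
∏-++ []       ys f = sym (ℕP.+-identityʳ _)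
∏-++ (x ∷ xs) ys f = trans (cong (f x *_) (∏-++ xs ys f)) (sym (ℕP.*-assoc (f x) _ _))

∑-cong : (xs : List A) {f g : A → ℕ} → (∀ x → f x ≡ g x) → ∑ xs f ≡ ∑ xs g
∑-cong []       f≡g = refl
∑-cong (x ∷ xs) f≡g = cong₂ _+_ (f≡g x) (∑-cong xs f≡g)

∑-cong∈ : (xs : List A) {f g : A → ℕ} → (∀ x → x ∈ xs → f x ≡ g x) → ∑ xs f ≡ ∑ xs g
∑-cong∈ []       f≡g = refl
∑-cong∈ (x ∷ xs) f≡g = cong₂ _+_ (f≡g x (here refl)) (∑-cong∈ xs (λ y y∈ → f≡g y (there y∈)))

∏-cong : (xs : List A) {f g : A → ℕ} → (∀ x → f x ≡ g x) → ∏ xs f ≡ ∏ xs g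
∏-cong []       f≡g = refl
∏-cong (x ∷ xs) f≡g = cong₂ _*_ (f≡g x) (∏-cong xs f≡g)

∑-*ˡ : (xs : List A) (c : ℕ) (f : A → ℕ) → ∑ xs (λ x → c * f x) ≡ c * ∑ xs f
∑-*ˡ []       c f = sym (ℕP.*-zeroʳ c)
∑-*ˡ (x ∷ xs) c f = trans (cong (_+_ (c * f x)) (∑-*ˡ xs c f)) (sym (ℕP.*-distribˡ-+ c (f x) _))

∑-*ʳ : (xs : List A) (c : ℕ) (f : A → ℕ) → ∑ xs (λ x → f x * c) ≡ ∑ xs f * c
∑-*ʳ []       c f = refl
∑-*ʳ (x ∷ xs) c f = trans (cong (_+_ (f x * c)) (∑-*ʳ xs c f)) (sym (ℕP.*-distribʳ-+ c (f x) _))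

∑-+ : (xs : List A) (f g : A → ℕ) → ∑ xs (λ x → f x + g x) ≡ ∑ xs f + ∑ xs g
∑-+ []       f g = refl
∑-+ (x ∷ xs) f g = trans (cong (_+_ (f x + g x)) (∑-+ xs f g)) (interchange (f x) (g x) (∑ xs f) (∑ xs g))
  where
    interchange : ∀ a b c d → (a + b) + (c + d) ≡ (a + c) + (b + d)
    interchange = solve-∀

∑-const : (xs : List A) (c : ℕ) → ∑ xs (λ _ → c) ≡ c * length xs
∑-const []       c = sym (ℕP.*-zeroʳ c)
∑-const (x ∷ xs) c = trans (cong (_+_ c) (∑-const xs c)) (sym (ℕP.*-suc c _))

∑-map : (h : A → B) (xs : List A) (f : B → ℕ) → ∑ (map h xs) f ≡ ∑ xs (f ∘ h)
∑-map h []       f = refl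
∑-map h (x ∷ xs) f = cong (_+_ (f (h x))) (∑-map h xs f)

∏-map : (h : A → B) (xs : List A) (f : B → ℕ) → ∏ (map h xs) f ≡ ∏ xs (f ∘ h)
∏-map h []       f = refl
∏-map h (x ∷ xs) f = cong (f (h x) *_) (∏-map h xs f)

∑-concatMap : (g : A → List B) (xs : List A) (f : B → ℕ) → ∑ (concatMap g xs) f ≡ ∑ xs (λ x → ∑ (g x) f)
∑-concatMap g []       f = refl
∑-concatMap g (x ∷ xs) f = trans (∑-++ (g x) _ f) (cong (_+_ (∑ (g x) f)) (∑-concatMap g xs f))

∏-concatMap : (g : A → List B) (xs : List A) (f : B → ℕ) → ∏ (concatMap g xs) f ≡ ∏ xs (λ x → ∏ (g x) f)
∏-concatMap g []       f = refl
∏-concatMap g (x ∷ xs) f = trans (∏-++ (g x) _ f) (cong (∏ (g x) f *_) (∏-concatMap g xs f))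

∏-allFin-suc : (n : ℕ) (h : Fin (suc n) → ℕ) → ∏ (allFin (suc n)) h ≡ h zero * ∏ (allFin n) (h ∘ suc)
∏-allFin-suc n h =
  cong (h zero *_) (trans (cong (λ ls → ∏ ls h) (sym (map-tabulate id suc))) (∏-map suc (allFin n) h))

length-filter : {P : Pred A 0ℓ} (P? : Decidable P) (xs : List A) → length (filter P? xs) ≡ ∑ xs (𝟙 ∘ P?)
length-filter P? []       = refl
length-filter P? (x ∷ xs) with does (P? x)
... | true  = cong suc (length-filter P? xs)
... | false = length-filter P? xs

𝟙-all : {P : Pred A 0ℓ} (P? : Decidable P) (xs : List A) → 𝟙 (all? P? xs) ≡ ∏ xs (𝟙 ∘ P?)
𝟙-all P? []       = refl
𝟙-all P? (x ∷ xs) = trans (𝟙ᵇ-∧ (does (P? x)) (does (all? P? xs))) (cong (𝟙 (P? x) *_) (𝟙-all P? xs))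

∑-allVecs-∷ : (n : ℕ) (xs : List A) (f : Vec A (suc n) → ℕ) →
  ∑ (allVecs (suc n) xs) f ≡ ∑ xs (λ x → ∑ (allVecs n xs) (λ w → f (x ∷ w)))
∑-allVecs-∷ n xs f = trans (∑-concatMap _ xs f) (∑-cong xs (λ x → ∑-map (x ∷_) (allVecs n xs) f))

∑-allVecs-++ : (a b : ℕ) (xs : List A) (f : Vec A (a + b) → ℕ) →
  ∑ (allVecs (a + b) xs) f ≡ ∑ (allVecs a xs) (λ w → ∑ (allVecs b xs) (λ w′ → f (w Vec.++ w′)))
∑-allVecs-++ zero    b xs f = sym (ℕP.+-identityʳ _)
∑-allVecs-++ (suc a) b xs f = begin
    ∑ (allVecs (suc (a + b)) xs) f
  ≡⟨ ∑-allVecs-∷ (a + b) xs f ⟩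
    ∑ xs (λ x → ∑ (allVecs (a + b) xs) (λ w → f (x ∷ w)))
  ≡⟨ ∑-cong xs (λ x → ∑-allVecs-++ a b xs (λ w → f (x ∷ w))) ⟩
    ∑ xs (λ x → ∑ (allVecs a xs) (λ w → ∑ (allVecs b xs) (λ w′ → f (x ∷ (w Vec.++ w′)))))
  ≡⟨ sym (∑-allVecs-∷ a xs _) ⟩
    ∑ (allVecs (suc a) xs) (λ w → ∑ (allVecs b xs) (λ w′ → f (w Vec.++ w′)))
  ∎

-- Indicator that consecutive entries differ: properness of a positive path coloured by the list.
properWalk : List ℤ → ℕ
properWalk []           = 1
properWalk (a ∷ [])     = 1
properWalk (a ∷ b ∷ cs) = 𝟙 (¬? (b ≟ a)) * properWalk (b ∷ cs)

𝟙-pathEdges : {n : ℕ} (c : Vec ℤ n) (vs : List (Fin n)) →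
  ∏ (pathEdges vs) (𝟙 ∘ properEdge? c) ≡ properWalk (map (lookup c) vs)
𝟙-pathEdges c []           = refl
𝟙-pathEdges c (x ∷ [])     = refl
𝟙-pathEdges c (x ∷ y ∷ vs) = cong₂ _*_
  (𝟙-⇔ (λ ne eq → ne (trans eq (sym (ℤP.*-identityˡ (lookup c x)))))
       (λ ne eq → ne (trans eq (ℤP.*-identityˡ (lookup c x))))
       (properEdge? c (x , y , pos)) (¬? (lookup c y ≟ lookup c x)))
  (𝟙-pathEdges c (y ∷ vs))

pageColours : (p n : ℕ) → Vec ℤ (n * p) → Fin n → List ℤ
pageColours p n rest l = tabulate (λ j → lookup rest (combine l j))

properPages : (p n : ℕ) → Vec ℤ (n * p) → ℤ → ℤ → ℕ
properPages p n rest a b = ∏ (allFin n) (λ l → properWalk (a ∷ pageColours p n rest l ++ b ∷ []))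

uvProper : ℤ → ℤ → ℕ
uvProper a b = 𝟙 (¬? (b ≟ ⟦ pos ⟧ ℤ.* a)) * 𝟙 (¬? (b ≟ ⟦ neg ⟧ ℤ.* a))

uvProper-diag : (a : ℤ) → uvProper a a ≡ 0
uvProper-diag a = cong (_* 𝟙 (¬? (a ≟ ⟦ neg ⟧ ℤ.* a))) (𝟙-no (λ a≢a → a≢a (sym (ℤP.*-identityˡ a))) (¬? (a ≟ ⟦ pos ⟧ ℤ.* a)))

𝟙-properBook : (m n : ℕ) (a b : ℤ) (rest : Vec ℤ (n * (m ∸ 2))) →
  𝟙 (proper? (BookSigned m n) (a ∷ b ∷ rest)) ≡ uvProper a b * properPages (m ∸ 2) n rest a b
𝟙-properBook m n a b rest = begin
    𝟙 (proper? (BookSigned m n) c)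
  ≡⟨ 𝟙-all (properEdge? c) (edges (BookSigned m n)) ⟩
    edgeOK (zero , suc zero , pos) * (edgeOK (zero , suc zero , neg) * ∏ (concatMap page (allFin n)) edgeOK)
  ≡⟨ sym (ℕP.*-assoc (edgeOK (zero , suc zero , pos)) _ _) ⟩
    uvProper a b * ∏ (concatMap page (allFin n)) edgeOK
  ≡⟨ cong (uvProper a b *_) (∏-concatMap page (allFin n) edgeOK) ⟩
    uvProper a b * ∏ (allFin n) (λ l → ∏ (page l) edgeOK)
  ≡⟨ cong (uvProper a b *_) (∏-cong (allFin n) pageOK) ⟩
    uvProper a b * properPages p n rest a b
  ∎
  where
    p : ℕ
    p = m ∸ 2
    c : Vec ℤ (2 + n * p)
    c = a ∷ b ∷ rest
    edgeOK : Fin (2 + n * p) × Fin (2 + n * p) × Sign → ℕ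
    edgeOK = 𝟙 ∘ properEdge? c
    inner : Fin n → List (Fin (2 + n * p))
    inner l = map (λ j → 2 ↑ʳ combine l j) (allFin p)
    page : Fin n → List (Fin (2 + n * p) × Fin (2 + n * p) × Sign)
    page l = pathEdges (zero ∷ (inner l ++ suc zero ∷ []))
    innerColours : (l : Fin n) → map (lookup c) (inner l ++ suc zero ∷ []) ≡ pageColours p n rest l ++ b ∷ []
    innerColours l = trans (map-++ (lookup c) (inner l) _)
      (cong (_++ b ∷ []) (trans (cong (map (lookup c)) (map-tabulate id (λ j → 2 ↑ʳ combine l j)))
                                (map-tabulate (λ j → 2 ↑ʳ combine l j) (lookup c))))
    pageOK : (l : Fin n) → ∏ (page l) edgeOK ≡ properWalk (a ∷ pageColours p n rest l ++ b ∷ [])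
    pageOK l = trans (𝟙-pathEdges c (zero ∷ (inner l ++ suc zero ∷ []))) (cong (properWalk ∘ (a ∷_)) (innerColours l))

properPages-suc : (p n : ℕ) (w : Vec ℤ p) (rest : Vec ℤ (n * p)) (a b : ℤ) →
  properPages p (suc n) (w Vec.++ rest) a b ≡ properWalk (a ∷ tabulate (lookup w) ++ b ∷ []) * properPages p n rest a b
properPages-suc p n w rest a b = trans (∏-allFin-suc n (λ l → properWalk (a ∷ pageColours p (suc n) (w Vec.++ rest) l ++ b ∷ []))) (cong₂ _*_
  (cong (λ cs → properWalk (a ∷ cs ++ b ∷ [])) (tabulate-cong (lookup-++ˡ w rest)))
  (∏-cong (allFin n) (λ l → cong (λ cs → properWalk (a ∷ cs ++ b ∷ []))
                                 (tabulate-cong (λ j → lookup-++ʳ w rest (combine l j))))))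

-- Number of proper colourings, from the palette xs, of the p inner vertices of a positive path
-- whose end vertices have colours a and b.
walks : List ℤ → ℕ → ℤ → ℤ → ℕ
walks xs p a b = ∑ (allVecs p xs) (λ w → properWalk (a ∷ tabulate (lookup w) ++ b ∷ []))

-- The pages are coloured independently.
∑-properPages : (xs : List ℤ) (p n : ℕ) (a b : ℤ) →
  ∑ (allVecs (n * p) xs) (λ rest → properPages p n rest a b) ≡ walks xs p a b ^ n
∑-properPages xs p zero    a b = refl
∑-properPages xs p (suc n) a b = begin
    ∑ (allVecs (p + n * p) xs) (λ rest → properPages p (suc n) rest a b)
  ≡⟨ ∑-allVecs-++ p (n * p) xs _ ⟩
    ∑ (allVecs p xs) (λ w → ∑ (allVecs (n * p) xs) (λ rest → properPages p (suc n) (w Vec.++ rest) a b))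
  ≡⟨ ∑-cong (allVecs p xs) (λ w → trans (∑-cong (allVecs (n * p) xs) (λ rest → properPages-suc p n w rest a b))
                                         (∑-*ˡ (allVecs (n * p) xs) (firstPage w) _)) ⟩
    ∑ (allVecs p xs) (λ w → firstPage w * ∑ (allVecs (n * p) xs) (λ rest → properPages p n rest a b))
  ≡⟨ ∑-*ʳ (allVecs p xs) _ firstPage ⟩
    walks xs p a b * ∑ (allVecs (n * p) xs) (λ rest → properPages p n rest a b)
  ≡⟨ cong (walks xs p a b *_) (∑-properPages xs p n a b) ⟩
    walks xs p a b ^ suc n
  ∎
  where
    firstPage : Vec ℤ p → ℕ
    firstPage w = properWalk (a ∷ tabulate (lookup w) ++ b ∷ [])

bookCount : List ℤ → ℕ → ℕ → ℕ
bookCount xs p n = ∑ xs (λ a → ∑ xs (λ b → uvProper a b * walks xs p a b ^ n))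

χb-book : (m n k : ℕ) → χb (BookSigned m n) k ≡ bookCount (colours k) (m ∸ 2) n
χb-book m n k = begin
    length (filter (proper? G) (allVecs (2 + n * p) xs))
  ≡⟨ length-filter (proper? G) (allVecs (2 + n * p) xs) ⟩
    ∑ (allVecs (2 + n * p) xs) (𝟙 ∘ proper? G)
  ≡⟨ ∑-allVecs-∷ (suc (n * p)) xs _ ⟩
    ∑ xs (λ a → ∑ (allVecs (suc (n * p)) xs) (λ w → 𝟙 (proper? G (a ∷ w))))
  ≡⟨ ∑-cong xs (λ a → ∑-allVecs-∷ (n * p) xs _) ⟩
    ∑ xs (λ a → ∑ xs (λ b → ∑ (allVecs (n * p) xs) (λ rest → 𝟙 (proper? G (a ∷ b ∷ rest)))))
  ≡⟨ ∑-cong xs (λ a → ∑-cong xs (λ b → uvPages a b)) ⟩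
    bookCount xs p n
  ∎
  where
    G : SignedGraph
    G = BookSigned m n
    p : ℕ
    p = m ∸ 2
    xs : List ℤ
    xs = colours k
    uvPages : (a b : ℤ) → ∑ (allVecs (n * p) xs) (λ rest → 𝟙 (proper? G (a ∷ b ∷ rest))) ≡ uvProper a b * walks xs p a b ^ n
    uvPages a b = begin
        ∑ (allVecs (n * p) xs) (λ rest → 𝟙 (proper? G (a ∷ b ∷ rest)))
      ≡⟨ ∑-cong (allVecs (n * p) xs) (𝟙-properBook m n a b) ⟩
        ∑ (allVecs (n * p) xs) (λ rest → uvProper a b * properPages p n rest a b)
      ≡⟨ ∑-*ˡ (allVecs (n * p) xs) (uvProper a b) _ ⟩
        uvProper a b * ∑ (allVecs (n * p) xs) (λ rest → properPages p n rest a b)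
      ≡⟨ cong (uvProper a b *_) (∑-properPages xs p n a b) ⟩
        uvProper a b * walks xs p a b ^ n
      ∎

-- If all walks between distinct end colours number s, adding a page multiplies the count by s
-- (the uv factor kills the summands with equal end colours).
bookCount-suc : (xs : List ℤ) (p n s : ℕ) →
  (∀ a b → a ∈ xs → b ∈ xs → b ≢ a → walks xs p a b ≡ s) →
  bookCount xs p (suc n) ≡ s * bookCount xs p n
bookCount-suc xs p n s walks≡s =
  trans (∑-cong∈ xs (λ a a∈ → trans (∑-cong∈ xs (λ b b∈ → summand a b a∈ b∈)) (∑-*ˡ xs s _))) (∑-*ˡ xs s _)
  where
    swapFactors : ∀ u s t → u * (s * t) ≡ s * (u * t)
    swapFactors = solve-∀
    summand : ∀ a b → a ∈ xs → b ∈ xs → uvProper a b * walks xs p a b ^ suc n ≡ s * (uvProper a b * walks xs p a b ^ n)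
    summand a b a∈ b∈ with b ≟ a
    ... | yes refl rewrite uvProper-diag a = sym (ℕP.*-zeroʳ s)
    ... | no b≢a = trans (cong (λ t → uvProper a b * (t * walks xs p a b ^ n)) (walks≡s a b a∈ b∈ b≢a))
                         (swapFactors (uvProper a b) s _)

-- Choosing the colour x of the first inner vertex.
walks-suc : (xs : List ℤ) (p : ℕ) (a b : ℤ) → walks xs (suc p) a b ≡ ∑ xs (λ x → 𝟙 (¬? (x ≟ a)) * walks xs p x b)
walks-suc xs p a b = trans (∑-allVecs-∷ p xs _) (∑-cong xs (λ x → ∑-*ˡ (allVecs p xs) (𝟙 (¬? (x ≟ a))) _))

caseEq : {a b : ℤ} → ℕ → ℕ → Dec (a ≡ b) → ℕ
caseEq d s (yes _) = d
caseEq d s (no _)  = s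

caseEq-refl : {a : ℤ} (d s : ℕ) (a≟a : Dec (a ≡ a)) → caseEq d s a≟a ≡ d
caseEq-refl d s (yes _)   = refl
caseEq-refl d s (no a≢a) = ⊥-elim (a≢a refl)

caseEq-≢ : {a b : ℤ} (d s : ℕ) → a ≢ b → (a≟b : Dec (a ≡ b)) → caseEq d s a≟b ≡ s
caseEq-≢ d s a≢b (yes a≡b) = ⊥-elim (a≢b a≡b)
caseEq-≢ d s a≢b (no _)    = refl

walks-zero : (xs : List ℤ) (a b : ℤ) → walks xs zero a b ≡ caseEq 0 1 (a ≟ b)
walks-zero xs a b = trans (ℕP.+-identityʳ _) (trans (ℕP.*-identityʳ _) (edge (a ≟ b) (b ≟ a)))
  where
    edge : (a≟b : Dec (a ≡ b)) (b≟a : Dec (b ≡ a)) → 𝟙 (¬? b≟a) ≡ caseEq 0 1 a≟b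
    edge (yes _)   (yes _)   = refl
    edge (yes a≡b) (no b≢a)  = ⊥-elim (b≢a (sym a≡b))
    edge (no a≢b)  (yes b≡a) = ⊥-elim (a≢b (sym b≡a))
    edge (no _)    (no _)    = refl

-- Number of proper colourings of the p inner vertices of a path with distinct (resp. equal)
-- end colours, in a palette of r + 2 colours.
mutual
  distinctEnds : ℕ → ℕ → ℕ
  distinctEnds r zero    = 1
  distinctEnds r (suc p) = equalEnds r p + r * distinctEnds r p

  equalEnds : ℕ → ℕ → ℕ
  equalEnds r zero    = 0
  equalEnds r (suc p) = suc r * distinctEnds r p

mult : ℤ → List ℤ → ℕ
mult a xs = ∑ xs (λ x → 𝟙 (x ≟ a))

module Palette (xs : List ℤ) (r : ℕ) (size : length xs ≡ 2 + r) (once : ∀ {a} → a ∈ xs → mult a xs ≡ 1) where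

  ∑-except : ∀ {a} → a ∈ xs → (f : ℤ → ℕ) → ∑ xs (λ x → 𝟙 (¬? (x ≟ a)) * f x) + f a ≡ ∑ xs f
  ∑-except {a} a∈ f = begin
      ∑ xs (λ x → 𝟙 (¬? (x ≟ a)) * f x) + f a
    ≡⟨ cong (_+_ (∑ xs (λ x → 𝟙 (¬? (x ≟ a)) * f x))) (sym termAt-a) ⟩
      ∑ xs (λ x → 𝟙 (¬? (x ≟ a)) * f x) + ∑ xs (λ x → f a * 𝟙 (x ≟ a))
    ≡⟨ sym (∑-+ xs _ _) ⟩
      ∑ xs (λ x → 𝟙 (¬? (x ≟ a)) * f x + f a * 𝟙 (x ≟ a))
    ≡⟨ ∑-cong xs split ⟩
      ∑ xs f
    ∎
    where
      termAt-a : ∑ xs (λ x → f a * 𝟙 (x ≟ a)) ≡ f a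
      termAt-a = trans (∑-*ˡ xs (f a) _) (trans (cong (f a *_) (once a∈)) (ℕP.*-identityʳ (f a)))
      dropZeros : ∀ u v → u + 0 + v * 0 ≡ u
      dropZeros = solve-∀
      split : ∀ x → 𝟙 (¬? (x ≟ a)) * f x + f a * 𝟙 (x ≟ a) ≡ f x
      split x with x ≟ a
      ... | yes refl = ℕP.*-identityʳ (f x)
      ... | no _     = dropZeros (f x) (f a)

  ∑-others : ∀ {a} → a ∈ xs → (s : ℕ) → ∑ xs (λ x → 𝟙 (¬? (x ≟ a)) * s) ≡ suc r * s
  ∑-others {a} a∈ s = ℕP.+-cancelʳ-≡ s _ _ (begin
      ∑ xs (λ x → 𝟙 (¬? (x ≟ a)) * s) + s  ≡⟨ ∑-except a∈ (λ _ → s) ⟩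
      ∑ xs (λ _ → s)                       ≡⟨ ∑-const xs s ⟩
      s * length xs                        ≡⟨ cong (s *_) size ⟩
      s * (2 + r)                          ≡⟨ paletteSize s r ⟩
      suc r * s + s                        ∎)
    where
      paletteSize : ∀ s r → s * (2 + r) ≡ suc r * s + s
      paletteSize = solve-∀

  ∑-caseEq : ∀ {b} → b ∈ xs → (d s : ℕ) → ∑ xs (λ x → caseEq d s (x ≟ b)) ≡ suc r * s + d
  ∑-caseEq {b} b∈ d s = begin
      ∑ xs (λ x → caseEq d s (x ≟ b))
    ≡⟨ sym (∑-except b∈ _) ⟩
      ∑ xs (λ x → 𝟙 (¬? (x ≟ b)) * caseEq d s (x ≟ b)) + caseEq d s (b ≟ b)
    ≡⟨ cong₂ _+_ (∑-cong xs offDiagonal) (caseEq-refl d s (b ≟ b)) ⟩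
      ∑ xs (λ x → 𝟙 (¬? (x ≟ b)) * s) + d
    ≡⟨ cong (_+ d) (∑-others b∈ s) ⟩
      suc r * s + d
    ∎
    where
      offDiagonal : ∀ x → 𝟙 (¬? (x ≟ b)) * caseEq d s (x ≟ b) ≡ 𝟙 (¬? (x ≟ b)) * s
      offDiagonal x with x ≟ b
      ... | yes _ = refl
      ... | no _  = refl

  -- One step of the walk recursion: the first inner colour x avoids a, and the remaining
  -- count is d or s according to whether x = b.
  ∑-step : ∀ {a b} → a ∈ xs → b ∈ xs → (d s : ℕ) →
    ∑ xs (λ x → 𝟙 (¬? (x ≟ a)) * caseEq d s (x ≟ b)) ≡ caseEq (suc r * s) (d + r * s) (a ≟ b)
  ∑-step {a} {b} a∈ b∈ d s with a ≟ b | ∑-except a∈ (λ x → caseEq d s (x ≟ b))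
  ... | yes refl | T+d≡total = ℕP.+-cancelʳ-≡ d _ _ (trans T+d≡total (∑-caseEq b∈ d s))
  ... | no _     | T+s≡total = ℕP.+-cancelʳ-≡ s _ _ (trans T+s≡total (trans (∑-caseEq b∈ d s) (regroup d s r)))
    where
      regroup : ∀ d s r → suc r * s + d ≡ d + r * s + s
      regroup = solve-∀

  walks-count : (p : ℕ) {a b : ℤ} → a ∈ xs → b ∈ xs → walks xs p a b ≡ caseEq (equalEnds r p) (distinctEnds r p) (a ≟ b)
  walks-count zero    {a} {b} _  _  = walks-zero xs a b
  walks-count (suc p) {a} {b} a∈ b∈ = begin
      walks xs (suc p) a b
    ≡⟨ walks-suc xs p a b ⟩
      ∑ xs (λ x → 𝟙 (¬? (x ≟ a)) * walks xs p x b)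
    ≡⟨ ∑-cong∈ xs (λ x x∈ → cong (𝟙 (¬? (x ≟ a)) *_) (walks-count p x∈ b∈)) ⟩
      ∑ xs (λ x → 𝟙 (¬? (x ≟ a)) * caseEq (equalEnds r p) (distinctEnds r p) (x ≟ b))
    ≡⟨ ∑-step a∈ b∈ (equalEnds r p) (distinctEnds r p) ⟩
      caseEq (equalEnds r (suc p)) (distinctEnds r (suc p)) (a ≟ b)
    ∎

newColours : ℕ → List ℤ
newColours k = + suc k ∷ - (+ suc k) ∷ []

colours-suc : (k : ℕ) → colours (suc k) ≡ colours k ++ newColours k
colours-suc k = begin
    concatMap newColours (upTo (suc k))
  ≡⟨ cong (concatMap newColours) (sym (upTo-∷ʳ k)) ⟩
    concatMap newColours (upTo k ++ k ∷ [])
  ≡⟨ concatMap-++ newColours (upTo k) (k ∷ []) ⟩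
    colours k ++ (newColours k ++ [])
  ≡⟨ cong (colours k ++_) (++-identityʳ (newColours k)) ⟩
    colours k ++ newColours k
  ∎

length-colours : (k : ℕ) → length (colours k) ≡ 2 * k
length-colours zero    = refl
length-colours (suc k) = begin
    length (colours (suc k))           ≡⟨ cong length (colours-suc k) ⟩
    length (colours k ++ newColours k) ≡⟨ length-++ (colours k) ⟩
    length (colours k) + 2             ≡⟨ cong (_+ 2) (length-colours k) ⟩
    2 * k + 2                          ≡⟨ twoMore k ⟩
    2 * suc k                          ∎
  where
    twoMore : ∀ k → 2 * k + 2 ≡ 2 * suc k
    twoMore = solve-∀

∈-newColours : ∀ {k x} → x ∈ newColours k → ∣ x ∣ ≡ suc k
∈-newColours (here refl)         = refl
∈-newColours (there (here refl)) = refl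

∈-colours-suc : ∀ {k x} → x ∈ colours (suc k) → (x ∈ colours k) ⊎ (x ∈ newColours k)
∈-colours-suc {k} x∈ = ∈-++⁻ (colours k) (subst (_ ∈_) (colours-suc k) x∈)

colour-bound : ∀ {k x} → x ∈ colours k → ∣ x ∣ ≤ k
colour-bound {zero}  ()
colour-bound {suc k} x∈ with ∈-colours-suc x∈
... | inj₁ old = ℕP.≤-trans (colour-bound old) (ℕP.n≤1+n k)
... | inj₂ new = ℕP.≤-reflexive (∈-newColours new)

≢-by-size : ∀ {k x y} → ∣ x ∣ ≤ k → ∣ y ∣ ≡ suc k → x ≢ y
≢-by-size {k} ∣x∣≤k ∣y∣≡1+k refl = ℕP.<-irrefl refl (subst (_≤ k) ∣y∣≡1+k ∣x∣≤k)

mult-absent : ∀ {a} (xs : List ℤ) → (∀ {x} → x ∈ xs → x ≢ a) → mult a xs ≡ 0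
mult-absent []       absent = refl
mult-absent (x ∷ xs) absent =
  cong₂ _+_ (𝟙-no (absent (here refl)) (x ≟ _)) (mult-absent xs (absent ∘ there))

colour-once : ∀ {k a} → a ∈ colours k → mult a (colours k) ≡ 1
colour-once {zero}      ()
colour-once {suc k} {a} a∈ = trans (cong (mult a) (colours-suc k))
  (trans (∑-++ (colours k) (newColours k) _) (occurrences (∈-colours-suc a∈)))
  where
    occurrences : (a ∈ colours k) ⊎ (a ∈ newColours k) → mult a (colours k) + mult a (newColours k) ≡ 1
    occurrences (inj₁ old) = cong₂ _+_ (colour-once {k} old)
      (mult-absent {a} (newColours k) (λ x∈ x≡a → ≢-by-size (colour-bound old) (∈-newColours x∈) (sym x≡a)))
    occurrences (inj₂ new) = cong₂ _+_
      (mult-absent {a} (colours k) (λ x∈ → ≢-by-size (colour-bound x∈) (∈-newColours new)))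
      (newOnce new)
      where
        newOnce : a ∈ newColours k → mult a (newColours k) ≡ 1
        newOnce (here refl)         = cong₂ _+_ (𝟙-yes refl (+ suc k ≟ a)) (cong (_+ 0) (𝟙-no (λ ()) (- (+ suc k) ≟ a)))
        newOnce (there (here refl)) = cong₂ _+_ (𝟙-no (λ ()) (+ suc k ≟ a)) (cong (_+ 0) (𝟙-yes refl (- (+ suc k) ≟ a)))

-- colours (k + 1) is a palette with r = 2k.
length-colours-suc : (k : ℕ) → length (colours (suc k)) ≡ 2 + 2 * k
length-colours-suc k = trans (length-colours (suc k)) (ℕP.*-suc 2 k)

-- From a fixed start colour there are (r+1)^(p+1) walks; sorting them by the end colour gives
-- D(p) + (r+1)·S(p) = (r+1)^(p+1).
ends-total : (r p : ℕ) → equalEnds r p + suc r * distinctEnds r p ≡ suc r ^ suc p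
ends-total r zero    = refl
ends-total r (suc p) = begin
    suc r * distinctEnds r p + suc r * (equalEnds r p + r * distinctEnds r p)
  ≡⟨ factorOut r (distinctEnds r p) (equalEnds r p) ⟩
    suc r * (equalEnds r p + suc r * distinctEnds r p)
  ≡⟨ cong (suc r *_) (ends-total r p) ⟩
    suc r * suc r ^ suc p
  ∎
  where
    factorOut : ∀ r s d → suc r * s + suc r * (d + r * s) ≡ suc r * (d + suc r * s)
    factorOut = solve-∀

distinctEnds-step : (r p : ℕ) → distinctEnds r (suc p) + distinctEnds r p ≡ suc r ^ suc p
distinctEnds-step r p = trans (regroup (equalEnds r p) (distinctEnds r p) r) (ends-total r p)
  where
    regroup : ∀ d s r → d + r * s + s ≡ d + suc r * s
    regroup = solve-∀

pos-^ : (n p : ℕ) → + (n ^ p) ≡ (+ n) ℤ.^ p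
pos-^ n zero    = refl
pos-^ n (suc p) = trans (ℤP.pos-* n (n ^ p)) (cong (+ n ℤ.*_) (pos-^ n p))

altSum : ℤ → ℕ → (ℕ → ℕ) → ℕ → ℤ
altSum x p f n = foldr (λ i acc → ((- (+ 1)) ℤ.^ i) ℤ.* (x ℤ.^ (p ∸ i)) ℤ.+ acc) (+ 0) (applyUpTo f n)

-- Σ_{i=0}^{p} (-1)^i x^(p-i); bookFactor m k is this sum for x = 2k - 1 and p = m - 2.
alternating : ℤ → ℕ → ℤ
alternating x p = altSum x p id (suc p)

altSum-shift : (x : ℤ) (p : ℕ) (f : ℕ → ℕ) (n : ℕ) → altSum x (suc p) (suc ∘ f) n ≡ - altSum x p f n
altSum-shift x p f zero    = refl
altSum-shift x p f (suc n) =
  trans (cong (ℤ._+_ (((- (+ 1)) ℤ.^ suc (f 0)) ℤ.* (x ℤ.^ (p ∸ f 0)))) (altSum-shift x p (f ∘ suc) n))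
        (negateTerm ((- (+ 1)) ℤ.^ f 0) (x ℤ.^ (p ∸ f 0)) (altSum x p (f ∘ suc) n))
  where
    negateTerm : ∀ a b c → (- (+ 1) ℤ.* a) ℤ.* b ℤ.+ (- c) ≡ - (a ℤ.* b ℤ.+ c)
    negateTerm = ℤSolver.solve-∀

alternating-suc : (x : ℤ) (p : ℕ) → alternating x (suc p) ≡ x ℤ.^ suc p ℤ.- alternating x p
alternating-suc x p = cong₂ ℤ._+_ (ℤP.*-identityˡ (x ℤ.^ suc p)) (altSum-shift x p id (suc p))

+⇒- : {a b c : ℤ} → a ℤ.+ b ≡ c → a ≡ c ℤ.- b
+⇒- {a} {b} a+b≡c = trans (addSub a b) (cong (ℤ._- b) a+b≡c)
  where
    addSub : ∀ a b → a ≡ a ℤ.+ b ℤ.- b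
    addSub = ℤSolver.solve-∀

-- Both sides satisfy S(p+1) = x^(p+1) - S(p) with S(0) = 1.
distinctEnds-closed : (r p : ℕ) → + distinctEnds r p ≡ alternating (+ suc r) p
distinctEnds-closed r zero    = refl
distinctEnds-closed r (suc p) = begin
    + distinctEnds r (suc p)
  ≡⟨ +⇒- {b = + distinctEnds r p} (sym (ℤP.pos-+ (distinctEnds r (suc p)) (distinctEnds r p))) ⟩
    + (distinctEnds r (suc p) + distinctEnds r p) ℤ.- + distinctEnds r p
  ≡⟨ cong₂ ℤ._-_ (trans (cong +_ (distinctEnds-step r p)) (pos-^ (suc r) (suc p))) (distinctEnds-closed r p) ⟩
    (+ suc r) ℤ.^ suc p ℤ.- alternating (+ suc r) p
  ≡⟨ sym (alternating-suc (+ suc r) p) ⟩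
    alternating (+ suc r) (suc p)
  ∎

χb-book-suc : (m n k : ℕ) →
  χb (BookSigned m (suc n)) (suc k) ≡ distinctEnds (2 * k) (m ∸ 2) * χb (BookSigned m n) (suc k)
χb-book-suc m n k = begin
    χb (BookSigned m (suc n)) (suc k)          ≡⟨ χb-book m (suc n) (suc k) ⟩
    bookCount xs p (suc n)                     ≡⟨ bookCount-suc xs p n _ distinct ⟩
    distinctEnds r p * bookCount xs p n        ≡⟨ cong (distinctEnds r p *_) (sym (χb-book m n (suc k))) ⟩
    distinctEnds r p * χb (BookSigned m n) (suc k) ∎
  where
    r p : ℕ
    r = 2 * k
    p = m ∸ 2
    xs : List ℤ
    xs = colours (suc k)
    open Palette xs r (length-colours-suc k) (colour-once {suc k})
    distinct : ∀ a b → a ∈ xs → b ∈ xs → b ≢ a → walks xs p a b ≡ distinctEnds r p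
    distinct a b a∈ b∈ b≢a = trans (walks-count p a∈ b∈) (caseEq-≢ _ _ (b≢a ∘ sym) (a ≟ b))

-- The factor of the paper is that page count: here 2(k+1) - 1 = 2k + 1.
bookFactor-closed : (m k : ℕ) → bookFactor m (suc k) ≡ + distinctEnds (2 * k) (m ∸ 2)
bookFactor-closed m k = sym (trans (distinctEnds-closed (2 * k) (m ∸ 2))
  (cong (λ q → alternating (+ q) (m ∸ 2)) (sym (cong (_∸ 1) (ℕP.*-suc 2 k)))))

-- The recursion uses only n ≥ 1 and k ≥ 1.
proposition7p5 : (m n k : ℕ) → 3 ≤ m → 2 ≤ n → 1 ≤ k →
    + χb (BookSigned m n) k ≡ bookFactor m k ℤ.* + χb (BookSigned m (n ∸ 1)) k
proposition7p5 m (suc n) (suc k) _ (s≤s _) (s≤s _) = begin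
    + χb (BookSigned m (suc n)) (suc k)
  ≡⟨ cong +_ (χb-book-suc m n k) ⟩
    + (distinctEnds (2 * k) (m ∸ 2) * χb (BookSigned m n) (suc k))
  ≡⟨ ℤP.pos-* (distinctEnds (2 * k) (m ∸ 2)) _ ⟩
    + distinctEnds (2 * k) (m ∸ 2) ℤ.* + χb (BookSigned m n) (suc k)
  ≡⟨ cong (ℤ._* + χb (BookSigned m n) (suc k)) (sym (bookFactor-closed m k)) ⟩
    bookFactor m (suc k) ℤ.* + χb (BookSigned m n) (suc k)
  ∎
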